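{- For every positive integer $d$ and every integer $m$ with $0\le m\le d$, $$d!\,a(P_d,m)=\sum_{\sigma\in S_d}a(G_\sigma,m).$$
   Context: $P_d$ is the path graph on $d$ vertices $0,\dots,d-1$ with edges $\{j,j+1\}$. For $\sigma\in S_d$, $G_\sigma$ is the directed graph with vertex set $[d]$ and one directed edge $s\to\sigma(s)$ for each $s\in[d]$ (so fixed points give loops and a $2$-cycle $(a\,b)$ gives two distinct edges $a\to b$, $b\to a$). A matching of a graph is a set of edges, none of them loops, no two of which share an endpoint; $a(G,m)$ is the number of matchings of $G$ with exactly $m$ edges. -}

module Defs where

open import Data.Nat using (ℕ; zero; suc; _+_; _≡ᵇ_)
open import Data.Bool using (Bool; true; false; _∧_; not; if_then_else_)
open import Data.Fin using (Fin; zero; suc; toℕ; inject₁; fromℕ)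
open import Data.Fin.Properties using (_≟_)
open import Data.Product using (_×_; _,_)
open import Data.List using (List; []; _∷_; _++_; map; length; concatMap; allFin)
open import Data.Vec using (Vec; []; _∷_; toList; lookup)
open import Relation.Nullary.Decidable using (⌊_⌋)

-- A (multi)graph on vertex set Fin d, given as a list of edges; an edge is
-- an ordered pair of endpoints, read as an undirected edge for matchings.
-- Parallel edges are distinct list entries.
Graph : ℕ → Set
Graph d = List (Fin d × Fin d)

-- All sub-lists, one for each subset of positions (so parallel edges are
-- distinguished, and each subset of the edge multiset is counted once).
sublists : {A : Set} → List A → List (List A)
sublists []       = [] ∷ []
sublists (x ∷ xs) = map (x ∷_) (sublists xs) ++ sublists xs

count : {A : Set} → (A → Bool) → List A → ℕ
count p []       = 0
count p (x ∷ xs) = if p x then suc (count p xs) else count p xs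

_=ᶠ_ : {d : ℕ} → Fin d → Fin d → Bool
a =ᶠ b = ⌊ a ≟ b ⌋

isLoop : {d : ℕ} → Fin d × Fin d → Bool
isLoop (a , b) = a =ᶠ b

share : {d : ℕ} → Fin d × Fin d → Fin d × Fin d → Bool
share (a , b) (c , e) = (a =ᶠ c) Data.Bool.∨ (a =ᶠ e) Data.Bool.∨ (b =ᶠ c) Data.Bool.∨ (b =ᶠ e)

allB : {A : Set} → (A → Bool) → List A → Bool
allB p []       = true
allB p (x ∷ xs) = p x ∧ allB p xs

isMatching : {d : ℕ} → List (Fin d × Fin d) → Bool
isMatching []       = true
isMatching (e ∷ es) = not (isLoop e) ∧ allB (λ f → not (share e f)) es ∧ isMatching es

a : {d : ℕ} → Graph d → ℕ → ℕ
a G m = count (λ s → isMatching s ∧ (length s ≡ᵇ m)) (sublists G)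

-- the path graph P_d : edges {j, j+1} for 0 ≤ j < d - 1
pathEdges : (n : ℕ) → List (Fin (suc n) × Fin (suc n))
pathEdges zero    = []
pathEdges (suc n) = map (λ { (x , y) → (inject₁ x , inject₁ y) }) (pathEdges n)
                    ++ ((inject₁ (fromℕ n) , fromℕ (suc n)) ∷ [])

P : (d : ℕ) → Graph d
P zero    = []
P (suc n) = pathEdges n

-- maps [d] → [d] as vectors of images; S_d = the injective ones
allVecs : (d n : ℕ) → List (Vec (Fin d) n)
allVecs d zero    = [] ∷ []
allVecs d (suc n) = concatMap (λ x → map (x ∷_) (allVecs d n)) (allFin d)

distinct : {d : ℕ} → List (Fin d) → Bool
distinct []       = true
distinct (x ∷ xs) = allB (λ y → not (x =ᶠ y)) xs ∧ distinct xs

-- list of all permutations σ ∈ S_d (σ(s) = lookup σ s), each exactly once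
perms : (d : ℕ) → List (Vec (Fin d) d)
perms d = Data.List.filterᵇ (λ v → distinct (toList v)) (allVecs d d)

Gσ : {d : ℕ} → Vec (Fin d) d → Graph d
Gσ {d} σ = map (λ s → (s , lookup σ s)) (allFin d)

module Submission where

-- Both sides are evaluated in closed form.
--
-- Left side: splitting the m-matchings of a path according to whether they use its first
-- edge gives Pascal's recursion, so a(P_d, m) = (d-m) C m.
--
-- Right side: for a permutation σ, a set of edges {s → σ s : s ∈ S} is a matching iff
-- σ(S) ∩ S = ∅, so a(G_σ, m) counts the m-sets S with σ(S) ∩ S = ∅.  Exchanging the two
-- sums, we count for each m-set S the permutations with σ(S) ∩ S = ∅.  Building σ entry by
-- entry, the count of such injective sequences only depends on how many unused values lie
-- outside and inside S; solving this recursion gives (d-m) ↓ m · (d-m)! (falling factorial),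
-- hence Σ_σ a(G_σ, m) = (d-m) ↓ m · (d-m)! · d C m.

open import Defs
open import Data.Nat using (ℕ; zero; suc; _+_; _*_; _∸_; _≤_; _<_; _≤?_; _≡ᵇ_; s≤s; z≤n; pred; _!)
import Data.Nat.Properties as ℕ
open import Data.Nat.Solver using (module +-*-Solver)
open import Data.Nat.ListAction using (sum)
open import Data.Nat.ListAction.Properties using (sum-++)
open import Data.Nat.Combinatorics using (_C_; nCk+nC[k+1]≡[n+1]C[k+1]; k>n⇒nCk≡0; nCk≡n!/k![n-k]!; k![n∸k]!∣n!)
open import Data.Nat.DivMod using (m/n*n≡m)
open import Data.Bool using (Bool; true; false; _∧_; _∨_; not; if_then_else_; T)
open import Data.Unit using (tt)
import Data.Bool.Properties as Bool
import Algebra.Solver.IdempotentCommutativeMonoid as ∧-Solver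
open import Data.Fin using (Fin; zero; suc; inject₁; fromℕ)
open import Data.Fin.Properties using (_≟_)
open import Data.Product using (_×_; _,_; proj₁; proj₂)
open import Data.List using (List; []; _∷_; _++_; map; length; concatMap; allFin; filterᵇ)
import Data.List.Properties as List
open import Data.List.Relation.Binary.Sublist.Propositional using (_⊆_; []; _∷_; _∷ʳ_)
open import Data.Vec using (Vec; []; _∷_; toList; lookup)
open import Relation.Binary.PropositionalEquality
open import Relation.Nullary using (yes; no)
open import Function using (_∘_)
open import Data.Empty using (⊥; ⊥-elim)
open import Algebra.Properties.CommutativeSemigroup ℕ.+-commutativeSemigroup using (interchange)

=ᶠ-refl : ∀ {n} (x : Fin n) → (x =ᶠ x) ≡ true
=ᶠ-refl x with x ≟ x
... | yes _   = refl
... | no x≢x = ⊥-elim (x≢x refl)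

=ᶠ-sound : ∀ {n} {x y : Fin n} → (x =ᶠ y) ≡ true → x ≡ y
=ᶠ-sound {x = x} {y} x=y with x ≟ y
... | yes x≡y = x≡y

=ᶠ-sym : ∀ {n} (x y : Fin n) → (x =ᶠ y) ≡ (y =ᶠ x)
=ᶠ-sym x y with x ≟ y | y ≟ x
... | yes _   | yes _   = refl
... | no _    | no _    = refl
... | yes x≡y | no y≢x = ⊥-elim (y≢x (sym x≡y))
... | no x≢y | yes y≡x = ⊥-elim (x≢y (sym y≡x))

=ᶠ-suc : ∀ {n} (x y : Fin n) → (suc x =ᶠ suc y) ≡ (x =ᶠ y)
=ᶠ-suc x y with x ≟ y
... | yes _ = refl
... | no _  = refl

∧-elim : ∀ {b c : Bool} → (b ∧ c) ≡ true → b ≡ true × c ≡ true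
∧-elim {true} {true} _ = refl , refl

∧-intro : ∀ {b c : Bool} → b ≡ true → c ≡ true → (b ∧ c) ≡ true
∧-intro refl refl = refl

not-∨ : ∀ b c → not (b ∨ c) ≡ (not b ∧ not c)
not-∨ true  c = refl
not-∨ false c = refl

bool-ext : ∀ {b c : Bool} → (b ≡ true → c ≡ true) → (c ≡ true → b ≡ true) → b ≡ c
bool-ext {true}  {true}  _ _ = refl
bool-ext {true}  {false} f _ = sym (f refl)
bool-ext {false} {true}  _ g = g refl
bool-ext {false} {false} _ _ = refl

module _ {A : Set} where
  allB-cong : (l : List A) {p q : A → Bool} → (∀ x → p x ≡ q x) → allB p l ≡ allB q l
  allB-cong []      _ = refl
  allB-cong (x ∷ l) e = cong₂ _∧_ (e x) (allB-cong l e)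

  allB-cong-on : (l : List A) (r : A → Bool) {p q : A → Bool} → allB r l ≡ true →
                 (∀ x → r x ≡ true → p x ≡ q x) → allB p l ≡ allB q l
  allB-cong-on []      r _ _ = refl
  allB-cong-on (x ∷ l) r h e =
    let (rx , rl) = ∧-elim {r x} h in cong₂ _∧_ (e x rx) (allB-cong-on l r rl e)

  allB-∧ : (l : List A) (p q : A → Bool) → allB (λ x → p x ∧ q x) l ≡ (allB p l ∧ allB q l)
  allB-∧ []      p q = refl
  allB-∧ (x ∷ l) p q with p x | q x
  ... | true  | true  = allB-∧ l p q
  ... | true  | false = sym (Bool.∧-zeroʳ (allB p l))
  ... | false | _     = refl

  allB-true : (l : List A) → allB (λ _ → true) l ≡ true
  allB-true []      = refl
  allB-true (x ∷ l) = allB-true l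

  allB-⊆ : ∀ {S l} (p : A → Bool) → S ⊆ l → allB p l ≡ true → allB p S ≡ true
  allB-⊆ p []               _ = refl
  allB-⊆ p (_∷_ {x = x} refl s) h = let (px , pl) = ∧-elim {p x} h in ∧-intro px (allB-⊆ p s pl)
  allB-⊆ p (x ∷ʳ s)         h = allB-⊆ p s (proj₂ (∧-elim {p x} h))

allB-map : {A B : Set} (f : A → B) (p : B → Bool) (l : List A) → allB p (map f l) ≡ allB (p ∘ f) l
allB-map f p []      = refl
allB-map f p (x ∷ l) = cong (p (f x) ∧_) (allB-map f p l)

Σ : {A : Set} → List A → (A → ℕ) → ℕ
Σ l f = sum (map f l)

ι : Bool → ℕ
ι true  = 1
ι false = 0

ι-∧ : ∀ b c → ι (b ∧ c) ≡ ι b * ι c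
ι-∧ true  c = sym (ℕ.+-identityʳ (ι c))
ι-∧ false c = refl

module _ {A : Set} where
  Σ-++ : (xs ys : List A) (f : A → ℕ) → Σ (xs ++ ys) f ≡ Σ xs f + Σ ys f
  Σ-++ xs ys f = trans (cong sum (List.map-++ f xs ys)) (sum-++ (map f xs) (map f ys))

  Σ-cong : (l : List A) {f g : A → ℕ} → (∀ x → f x ≡ g x) → Σ l f ≡ Σ l g
  Σ-cong []      e = refl
  Σ-cong (x ∷ l) e = cong₂ _+_ (e x) (Σ-cong l e)

  Σ-zero : (l : List A) → Σ l (λ _ → 0) ≡ 0
  Σ-zero []      = refl
  Σ-zero (x ∷ l) = Σ-zero l

  Σ-+ : (l : List A) (f g : A → ℕ) → Σ l (λ x → f x + g x) ≡ Σ l f + Σ l g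
  Σ-+ []      f g = refl
  Σ-+ (x ∷ l) f g = trans (cong (f x + g x +_) (Σ-+ l f g)) (interchange (f x) (g x) (Σ l f) (Σ l g))

  Σ-*ˡ : (l : List A) (k : ℕ) (f : A → ℕ) → Σ l (λ x → k * f x) ≡ k * Σ l f
  Σ-*ˡ []      k f = sym (ℕ.*-zeroʳ k)
  Σ-*ˡ (x ∷ l) k f = trans (cong (k * f x +_) (Σ-*ˡ l k f)) (sym (ℕ.*-distribˡ-+ k (f x) (Σ l f)))

  Σ-*ʳ : (l : List A) (k : ℕ) (f : A → ℕ) → Σ l (λ x → f x * k) ≡ Σ l f * k
  Σ-*ʳ l k f = trans (Σ-cong l (λ x → ℕ.*-comm (f x) k)) (trans (Σ-*ˡ l k f) (ℕ.*-comm k (Σ l f)))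

  count≡Σ : (p : A → Bool) (l : List A) → count p l ≡ Σ l (ι ∘ p)
  count≡Σ p []      = refl
  count≡Σ p (x ∷ l) with p x
  ... | true  = cong suc (count≡Σ p l)
  ... | false = count≡Σ p l

  Σ-filter : (p : A → Bool) (l : List A) (f : A → ℕ) →
             Σ (filterᵇ p l) f ≡ Σ l (λ x → if p x then f x else 0)
  Σ-filter p []      f = refl
  Σ-filter p (x ∷ l) f with p x
  ... | true  = cong (f x +_) (Σ-filter p l f)
  ... | false = Σ-filter p l f

  Σ-count : (p : A → Bool) (l : List A) (k : ℕ) → Σ l (λ x → ι (p x) * k) ≡ count p l * k
  Σ-count p l k = trans (Σ-*ʳ l k (ι ∘ p)) (cong (_* k) (sym (count≡Σ p l)))

  count-++ : (p : A → Bool) (xs ys : List A) → count p (xs ++ ys) ≡ count p xs + count p ys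
  count-++ p xs ys = trans (count≡Σ p (xs ++ ys))
    (trans (Σ-++ xs ys (ι ∘ p)) (sym (cong₂ _+_ (count≡Σ p xs) (count≡Σ p ys))))

  count-cong : (l : List A) {p q : A → Bool} → (∀ x → p x ≡ q x) → count p l ≡ count q l
  count-cong l {p} {q} e = trans (count≡Σ p l) (trans (Σ-cong l (cong ι ∘ e)) (sym (count≡Σ q l)))

  count-cong-on : (l : List A) (r : A → Bool) {p q : A → Bool} → allB r l ≡ true →
                  (∀ x → r x ≡ true → p x ≡ q x) → count p l ≡ count q l
  count-cong-on []      r _ _ = refl
  count-cong-on (x ∷ l) r {p} {q} h e with ∧-elim {r x} h
  ... | rx , rl rewrite e x rx = cong (λ k → if q x then suc k else k) (count-cong-on l r rl e)

  count-false : (l : List A) → count (λ _ → false) l ≡ 0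
  count-false l = trans (count≡Σ _ l) (Σ-zero l)

  count-split : (b p : A → Bool) (l : List A) →
                count p l ≡ count (λ y → not (b y) ∧ p y) l + count (λ y → b y ∧ p y) l
  count-split b p []      = refl
  count-split b p (x ∷ l) with b x | p x
  ... | true  | true  = trans (cong suc (count-split b p l)) (sym (ℕ.+-suc _ _))
  ... | true  | false = count-split b p l
  ... | false | true  = cong suc (count-split b p l)
  ... | false | false = count-split b p l

  count-not : (p : A → Bool) (l : List A) → count (not ∘ p) l + count p l ≡ length l
  count-not p []      = refl
  count-not p (x ∷ l) with p x
  ... | true  = trans (ℕ.+-suc _ _) (cong suc (count-not p l))
  ... | false = cong suc (count-not p l)

module _ {A B : Set} where
  Σ-map : (g : A → B) (l : List A) (f : B → ℕ) → Σ (map g l) f ≡ Σ l (f ∘ g)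
  Σ-map g l f = cong sum (sym (List.map-∘ l))

  count-map : (g : A → B) (l : List A) (p : B → Bool) → count p (map g l) ≡ count (p ∘ g) l
  count-map g l p = trans (count≡Σ p (map g l)) (trans (Σ-map g l (ι ∘ p)) (sym (count≡Σ (p ∘ g) l)))

  Σ-swap : (xs : List A) (ys : List B) (f : A → B → ℕ) →
           Σ xs (λ x → Σ ys (f x)) ≡ Σ ys (λ y → Σ xs (λ x → f x y))
  Σ-swap []       ys f = sym (Σ-zero ys)
  Σ-swap (x ∷ xs) ys f =
    trans (cong (Σ ys (f x) +_) (Σ-swap xs ys f)) (sym (Σ-+ ys (f x) (λ y → Σ xs (λ x′ → f x′ y))))

  Σ-concatMap : (g : A → List B) (l : List A) (f : B → ℕ) →
                Σ (concatMap g l) f ≡ Σ l (λ x → Σ (g x) f)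
  Σ-concatMap g []      f = refl
  Σ-concatMap g (x ∷ l) f = trans (Σ-++ (g x) (concatMap g l) f) (cong (Σ (g x) f +_) (Σ-concatMap g l f))

module _ {A B : Set} where
  sublists-map : (g : A → B) (l : List A) → sublists (map g l) ≡ map (map g) (sublists l)
  sublists-map g []      = refl
  sublists-map g (x ∷ l) = begin
      map (g x ∷_) (sublists (map g l)) ++ sublists (map g l)
    ≡⟨ cong (λ z → map (g x ∷_) z ++ z) (sublists-map g l) ⟩
      map (g x ∷_) (map (map g) (sublists l)) ++ map (map g) (sublists l)
    ≡⟨ cong (_++ map (map g) (sublists l)) (trans (sym (List.map-∘ (sublists l))) (List.map-∘ (sublists l))) ⟩
      map (map g) (map (x ∷_) (sublists l)) ++ map (map g) (sublists l)
    ≡⟨ sym (List.map-++ (map g) (map (x ∷_) (sublists l)) (sublists l)) ⟩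
      map (map g) (sublists (x ∷ l)) ∎
    where open ≡-Reasoning

module _ {A : Set} where
  Σ-sublists-cong : (l : List A) {f g : List A → ℕ} → (∀ S → S ⊆ l → f S ≡ g S) →
                    Σ (sublists l) f ≡ Σ (sublists l) g
  Σ-sublists-cong []      e = cong (_+ 0) (e [] [])
  Σ-sublists-cong (x ∷ l) {f} {g} e = begin
      Σ (map (x ∷_) (sublists l) ++ sublists l) f
    ≡⟨ Σ-++ (map (x ∷_) (sublists l)) (sublists l) f ⟩
      Σ (map (x ∷_) (sublists l)) f + Σ (sublists l) f
    ≡⟨ cong₂ _+_ (trans (Σ-map (x ∷_) (sublists l) f)
                   (trans (Σ-sublists-cong l (λ S s → e (x ∷ S) (refl ∷ s))) (sym (Σ-map (x ∷_) (sublists l) g))))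
                 (Σ-sublists-cong l (λ S s → e S (x ∷ʳ s))) ⟩
      Σ (map (x ∷_) (sublists l)) g + Σ (sublists l) g
    ≡⟨ sym (Σ-++ (map (x ∷_) (sublists l)) (sublists l) g) ⟩
      Σ (map (x ∷_) (sublists l) ++ sublists l) g ∎
    where open ≡-Reasoning

  count-sublists-of-length : (l : List A) (m : ℕ) →
                             count (λ S → length S ≡ᵇ m) (sublists l) ≡ length l C m
  count-sublists-of-length []      zero    = refl
  count-sublists-of-length []      (suc m) = refl
  count-sublists-of-length (x ∷ l) m = begin
      count (λ S → length S ≡ᵇ m) (map (x ∷_) (sublists l) ++ sublists l)
    ≡⟨ count-++ _ (map (x ∷_) (sublists l)) (sublists l) ⟩
      count (λ S → length S ≡ᵇ m) (map (x ∷_) (sublists l)) + count (λ S → length S ≡ᵇ m) (sublists l)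
    ≡⟨ cong (_+ count (λ S → length S ≡ᵇ m) (sublists l)) (count-map (x ∷_) (sublists l) _) ⟩
      count (λ S → suc (length S) ≡ᵇ m) (sublists l) + count (λ S → length S ≡ᵇ m) (sublists l)
    ≡⟨ pascal m ⟩
      suc (length l) C m ∎
    where
    open ≡-Reasoning
    pascal : ∀ m → count (λ S → suc (length S) ≡ᵇ m) (sublists l) + count (λ S → length S ≡ᵇ m) (sublists l)
                   ≡ suc (length l) C m
    pascal zero    = cong₂ _+_ (count-false (sublists l)) (count-sublists-of-length l zero)
    pascal (suc m) = trans (cong₂ _+_ (count-sublists-of-length l m) (count-sublists-of-length l (suc m)))
                           (nCk+nC[k+1]≡[n+1]C[k+1] (length l) m)

-- Matchings of the path graph.  We list the edges of the path from the vertex-0 end, so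
-- that the path on n+2 vertices is the edge {0,1} followed by a shifted path.

shift : ∀ {n} → Fin n × Fin n → Fin (suc n) × Fin (suc n)
shift (x , y) = (suc x , suc y)

widen : ∀ {n} → Fin n × Fin n → Fin (suc n) × Fin (suc n)
widen (x , y) = (inject₁ x , inject₁ y)

path : (n : ℕ) → Graph (suc n)
path zero    = []
path (suc n) = (zero , suc zero) ∷ map shift (path n)

path-snoc : ∀ n → path (suc n) ≡ map widen (path n) ++ (inject₁ (fromℕ n) , fromℕ (suc n)) ∷ []
path-snoc zero    = refl
path-snoc (suc n) = cong ((zero , suc zero) ∷_) (begin
    map shift (path (suc n))
  ≡⟨ cong (map shift) (path-snoc n) ⟩
    map shift (map widen (path n) ++ last ∷ [])
  ≡⟨ List.map-++ shift (map widen (path n)) (last ∷ []) ⟩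
    map shift (map widen (path n)) ++ shift last ∷ []
  ≡⟨ cong (_++ shift last ∷ []) (trans (sym (List.map-∘ (path n))) (List.map-∘ (path n))) ⟩
    map widen (map shift (path n)) ++ shift last ∷ [] ∎)
  where
  open ≡-Reasoning
  last = (inject₁ (fromℕ n) , fromℕ (suc n))

pathEdges≡path : ∀ n → pathEdges n ≡ path n
pathEdges≡path zero    = refl
pathEdges≡path (suc n) = trans
  (cong (_++ (inject₁ (fromℕ n) , fromℕ (suc n)) ∷ [])
        (trans (List.map-cong (λ { (x , y) → refl }) (pathEdges n)) (cong (map widen) (pathEdges≡path n))))
  (sym (path-snoc n))

isMatchingOfSize : ∀ {d} → ℕ → List (Fin d × Fin d) → Bool
isMatchingOfSize m s = isMatching s ∧ (length s ≡ᵇ m)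

isMatching-shift : ∀ {n} (s : List (Fin n × Fin n)) → isMatching (map shift s) ≡ isMatching s
isMatching-shift []            = refl
isMatching-shift ((x , y) ∷ s) = cong₂ _∧_ (cong not (=ᶠ-suc x y))
  (cong₂ _∧_ (trans (allB-map shift _ s) (allB-cong s shares)) (isMatching-shift s))
  where
  shares : ∀ f → not (share (shift (x , y)) (shift f)) ≡ not (share (x , y) f)
  shares (u , v) rewrite =ᶠ-suc x u | =ᶠ-suc x v | =ᶠ-suc y u | =ᶠ-suc y v = refl

a-shift : ∀ {n} (E : Graph n) m → a (map shift E) m ≡ a E m
a-shift E m = begin
    count (isMatchingOfSize m) (sublists (map shift E))
  ≡⟨ cong (count (isMatchingOfSize m)) (sublists-map shift E) ⟩
    count (isMatchingOfSize m) (map (map shift) (sublists E))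
  ≡⟨ count-map (map shift) (sublists E) (isMatchingOfSize m) ⟩
    count (isMatchingOfSize m ∘ map shift) (sublists E)
  ≡⟨ count-cong (sublists E) (λ s → cong₂ _∧_ (isMatching-shift s) (cong (_≡ᵇ m) (List.length-map shift s))) ⟩
    count (isMatchingOfSize m) (sublists E) ∎
  where open ≡-Reasoning

a-zero : ∀ {n} (E : Graph n) → a E 0 ≡ 1
a-zero []      = refl
a-zero (e ∷ E) = trans (count-++ (isMatchingOfSize 0) (map (e ∷_) (sublists E)) (sublists E))
  (cong₂ _+_ (trans (count-map (e ∷_) (sublists E) _) (trans (count-cong (sublists E) nonempty) (count-false (sublists E))))
             (a-zero E))
  where
  nonempty : ∀ s → isMatchingOfSize 0 (e ∷ s) ≡ false
  nonempty s = Bool.∧-zeroʳ (isMatching (e ∷ s))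

a-cons : ∀ {n} (e : Fin n × Fin n) (E : Graph n) m →
         a (e ∷ E) m ≡ count (isMatchingOfSize m ∘ (e ∷_)) (sublists E) + a E m
a-cons e E m = trans (count-++ (isMatchingOfSize m) (map (e ∷_) (sublists E)) (sublists E))
                     (cong (_+ a E m) (count-map (e ∷_) (sublists E) (isMatchingOfSize m)))

-- an (m+1)-matching of the path on k+3 vertices through the edge {0,1} avoids the edge {1,2},
-- and the rest is an m-matching of the path on the vertices 2, …, k+2
a-path-through-first-edge : ∀ k m →
  count (isMatchingOfSize (suc m) ∘ ((zero , suc zero) ∷_)) (sublists (map shift (path (suc k)))) ≡ a (path k) m
a-path-through-first-edge k m = begin
    count through (map (second ∷_) rest ++ rest)
  ≡⟨ count-++ through (map (second ∷_) rest) rest ⟩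
    count through (map (second ∷_) rest) + count through rest
  ≡⟨ cong (_+ count through rest) (trans (count-map (second ∷_) rest through) (count-false rest)) ⟩
    count through rest
  ≡⟨ cong (count through) (trans (sublists-map shift (map shift (path k)))
                                 (cong (map (map shift)) (sublists-map shift (path k)))) ⟩
    count through (map (map shift) (map (map shift) (sublists (path k))))
  ≡⟨ trans (count-map (map shift) (map (map shift) (sublists (path k))) through)
           (count-map (map shift) (sublists (path k)) (through ∘ map shift)) ⟩
    count (λ t → through (map shift (map shift t))) (sublists (path k))
  ≡⟨ count-cong (sublists (path k)) shifted-twice ⟩
    a (path k) m ∎
  where
  open ≡-Reasoning
  through = isMatchingOfSize (suc m) ∘ ((zero , suc zero) ∷_)
  second  = (suc zero , suc (suc zero))
  rest    = sublists (map shift (map shift (path k)))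
  disjoint : ∀ {j} (t : List (Fin (suc j) × Fin (suc j))) →
             allB (λ f → not (share (zero , suc zero) f)) (map shift (map shift t)) ≡ true
  disjoint []      = refl
  disjoint (_ ∷ t) = disjoint t
  shifted-twice : ∀ t → through (map shift (map shift t)) ≡ isMatchingOfSize m t
  shifted-twice t rewrite disjoint t | isMatching-shift (map shift t) | isMatching-shift t
                        | List.length-map shift (map shift t) | List.length-map shift t = refl

pascal-∸ : ∀ n m → (n ∸ m) C m + (n ∸ m) C suc m ≡ (suc n ∸ m) C suc m
pascal-∸ n m with m ≤? n
... | yes m≤n rewrite ℕ.+-∸-assoc 1 m≤n = nCk+nC[k+1]≡[n+1]C[k+1] (n ∸ m) m
... | no m≰n rewrite ℕ.m≤n⇒m∸n≡0 (ℕ.<⇒≤ (ℕ.≰⇒> m≰n)) | ℕ.m≤n⇒m∸n≡0 (ℕ.≰⇒> m≰n) =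
  cong (_+ 0 C suc m) (k>n⇒nCk≡0 (ℕ.≤-trans (s≤s z≤n) (ℕ.≰⇒> m≰n)))

a-path : ∀ n m → a (path n) m ≡ (suc n ∸ m) C m
a-path n             zero          = a-zero (path n)
a-path zero          (suc m)       = cong (_C suc m) (sym (ℕ.0∸n≡0 m))
a-path (suc zero)    (suc zero)    = refl
a-path (suc zero)    (suc (suc m)) = cong (_C suc (suc m)) (sym (ℕ.0∸n≡0 m))
a-path (suc (suc k)) (suc m) = begin
    a (path (suc (suc k))) (suc m)
  ≡⟨ a-cons (zero , suc zero) (map shift (path (suc k))) (suc m) ⟩
    _ + a (map shift (path (suc k))) (suc m)
  ≡⟨ cong₂ _+_ (a-path-through-first-edge k m) (a-shift (path (suc k)) (suc m)) ⟩
    a (path k) m + a (path (suc k)) (suc m)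
  ≡⟨ cong₂ _+_ (a-path k m) (a-path (suc k) (suc m)) ⟩
    (suc k ∸ m) C m + (suc k ∸ m) C suc m
  ≡⟨ pascal-∸ (suc k) m ⟩
    (suc (suc k) ∸ m) C suc m ∎
  where open ≡-Reasoning

=ᶠ-≢ : ∀ {n} {x y : Fin n} → not (x =ᶠ y) ≡ true → x ≡ y → ⊥
=ᶠ-≢ {x = x} h refl with trans (sym h) (cong not (=ᶠ-refl x))
... | ()

allB-lookup : ∀ {A : Set} {n} (p : A → Bool) (w : Vec A n) → allB p (toList w) ≡ true →
              ∀ j → p (lookup w j) ≡ true
allB-lookup p (x ∷ w) h zero    = proj₁ (∧-elim {p x} h)
allB-lookup p (x ∷ w) h (suc j) = allB-lookup p w (proj₂ (∧-elim {p x} h)) j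

distinct-injective : ∀ {d n} (v : Vec (Fin d) n) → distinct (toList v) ≡ true →
                     ∀ i j → lookup v i ≡ lookup v j → i ≡ j
distinct-injective (x ∷ w) h zero    zero    _ = refl
distinct-injective (x ∷ w) h zero    (suc j) e =
  ⊥-elim (=ᶠ-≢ (allB-lookup _ w (proj₁ (∧-elim {allB _ (toList w)} h)) j) e)
distinct-injective (x ∷ w) h (suc i) zero    e =
  ⊥-elim (=ᶠ-≢ (allB-lookup _ w (proj₁ (∧-elim {allB _ (toList w)} h)) i) (sym e))
distinct-injective (x ∷ w) h (suc i) (suc j) e =
  cong suc (distinct-injective w (proj₂ (∧-elim {allB _ (toList w)} h)) i j e)

distinct-=ᶠ : ∀ {d n} (v : Vec (Fin d) n) → distinct (toList v) ≡ true →
              ∀ i j → (lookup v i =ᶠ lookup v j) ≡ (i =ᶠ j)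
distinct-=ᶠ v h i j = bool-ext
  (λ e → trans (cong (i =ᶠ_) (sym (distinct-injective v h i j (=ᶠ-sound e)))) (=ᶠ-refl i))
  (λ e → trans (cong (λ k → lookup v i =ᶠ lookup v k) (sym (=ᶠ-sound e))) (=ᶠ-refl _))

distinct-⊆ : ∀ {n} {S l : List (Fin n)} → S ⊆ l → distinct l ≡ true → distinct S ≡ true
distinct-⊆ []                     _ = refl
distinct-⊆ (_∷_ {ys = l} refl s) h =
  let (fresh , rest) = ∧-elim {allB _ l} h in ∧-intro (allB-⊆ _ s fresh) (distinct-⊆ s rest)
distinct-⊆ (_∷ʳ_ {ys = l} x s) h = distinct-⊆ s (proj₂ (∧-elim {allB _ l} h))

allFin-suc : ∀ n → allFin (suc n) ≡ zero ∷ map suc (allFin n)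
allFin-suc n = cong (zero ∷_) (sym (List.map-tabulate (λ i → i) suc))

distinct-allFin : ∀ n → distinct (allFin n) ≡ true
distinct-allFin zero    = refl
distinct-allFin (suc n) = trans (cong distinct (allFin-suc n))
  (∧-intro (zero-fresh (allFin n)) (trans (distinct-suc (allFin n)) (distinct-allFin n)))
  where
  zero-fresh : (l : List (Fin n)) → allB (λ y → not (zero =ᶠ y)) (map suc l) ≡ true
  zero-fresh []      = refl
  zero-fresh (_ ∷ l) = zero-fresh l
  distinct-suc : (l : List (Fin n)) → distinct (map suc l) ≡ distinct l
  distinct-suc []      = refl
  distinct-suc (x ∷ l) = cong₂ _∧_
    (trans (allB-map suc _ l) (allB-cong l (λ y → cong not (=ᶠ-suc x y)))) (distinct-suc l)

infix 9 #_

#_ : ∀ {n} → (Fin n → Bool) → ℕ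
#_ {n} c = count c (allFin n)

#-step : ∀ {n} (c : Fin (suc n) → Bool) → # c ≡ ι (c zero) + # (c ∘ suc)
#-step {n} c = trans (cong (count c) (allFin-suc n))
  (trans (head (c zero) refl) (cong (ι (c zero) +_) (count-map suc (allFin n) c)))
  where
  head : ∀ b → c zero ≡ b → count c (zero ∷ map suc (allFin n)) ≡ ι b + count c (map suc (allFin n))
  head true  e rewrite e = refl
  head false e rewrite e = refl

count-at : ∀ {n} (x : Fin n) (p : Fin n → Bool) → count (λ y → (x =ᶠ y) ∧ p y) (allFin n) ≡ ι (p x)
count-at {suc n} zero    p = trans (#-step (λ y → (zero =ᶠ y) ∧ p y))
  (trans (cong (ι (p zero) +_) (count-false (allFin n))) (ℕ.+-identityʳ _))
count-at {suc n} (suc x) p = trans (#-step (λ y → (suc x =ᶠ y) ∧ p y))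
  (trans (count-cong (allFin n) (λ y → cong (_∧ p (suc y)) (=ᶠ-suc x y))) (count-at x (p ∘ suc)))

_∈ᵇ_ : ∀ {n} → Fin n → List (Fin n) → Bool
y ∈ᵇ []      = false
y ∈ᵇ (t ∷ U) = (t =ᶠ y) ∨ (y ∈ᵇ U)

∈ᵇ-allFin : ∀ {n} (y : Fin n) → y ∈ᵇ allFin n ≡ true
∈ᵇ-allFin {suc n} zero    = refl
∈ᵇ-allFin {suc n} (suc y) = trans (cong (suc y ∈ᵇ_) (allFin-suc n)) (trans (∈ᵇ-suc (allFin n)) (∈ᵇ-allFin y))
  where
  ∈ᵇ-suc : (l : List (Fin n)) → (suc y ∈ᵇ map suc l) ≡ (y ∈ᵇ l)
  ∈ᵇ-suc []      = refl
  ∈ᵇ-suc (t ∷ l) = cong₂ _∨_ (=ᶠ-suc t y) (∈ᵇ-suc l)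

not-∈ᵇ : ∀ {n} (y : Fin n) (S : List (Fin n)) → not (y ∈ᵇ S) ≡ allB (λ t → not (t =ᶠ y)) S
not-∈ᵇ y []      = refl
not-∈ᵇ y (t ∷ S) = trans (not-∨ (t =ᶠ y) (y ∈ᵇ S)) (cong (not (t =ᶠ y) ∧_) (not-∈ᵇ y S))

fresh-∉ : ∀ {n} (x : Fin n) (S : List (Fin n)) → allB (λ y → not (x =ᶠ y)) S ≡ true → (x ∈ᵇ S) ≡ false
fresh-∉ x S h = trans (sym (Bool.not-involutive (x ∈ᵇ S)))
  (cong not (trans (not-∈ᵇ x S) (trans (allB-cong S (λ t → cong not (=ᶠ-sym t x))) h)))

allB-∈ᵇ : ∀ {n} (p : Fin n → Bool) (S : List (Fin n)) → allB p S ≡ true →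
          ∀ y → y ∈ᵇ S ≡ true → p y ≡ true
allB-∈ᵇ p (t ∷ S) h y y∈S with ∧-elim {p t} h | t =ᶠ y in t=y
... | pt , _  | true  = subst (λ z → p z ≡ true) (=ᶠ-sound t=y) pt
... | _  , pS | false = allB-∈ᵇ p S pS y y∈S

∈ᵇ-allB : ∀ {n} (p : Fin n → Bool) (S : List (Fin n)) →
          (∀ y → y ∈ᵇ S ≡ true → p y ≡ true) → allB p S ≡ true
∈ᵇ-allB p []      h = refl
∈ᵇ-allB p (t ∷ S) h =
  ∧-intro (h t (cong (_∨ t ∈ᵇ S) (=ᶠ-refl t))) (∈ᵇ-allB p S (λ y y∈S → h y (later y∈S)))
  where
  later : ∀ {b c} → c ≡ true → (b ∨ c) ≡ true
  later {true}  _ = refl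
  later {false} e = e

allB-restrict : ∀ {n} (p : Fin n → Bool) (S : List (Fin n)) →
                allB p S ≡ allB (λ i → not (i ∈ᵇ S) ∨ p i) (allFin n)
allB-restrict {n} p S = bool-ext
  (λ h → ∈ᵇ-allB _ (allFin n) (λ y _ → outside-or y (allB-∈ᵇ p S h y)))
  (λ h → ∈ᵇ-allB p S (λ y y∈S → inside y y∈S (allB-∈ᵇ _ (allFin n) h y (∈ᵇ-allFin y))))
  where
  outside-or : ∀ y → (y ∈ᵇ S ≡ true → p y ≡ true) → (not (y ∈ᵇ S) ∨ p y) ≡ true
  outside-or y f with y ∈ᵇ S
  ... | true  = f refl
  ... | false = refl
  inside : ∀ y → y ∈ᵇ S ≡ true → (not (y ∈ᵇ S) ∨ p y) ≡ true → p y ≡ true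
  inside y y∈S h rewrite y∈S = h

count-∈ᵇ : ∀ {n} {S l : List (Fin n)} → distinct l ≡ true → S ⊆ l → count (_∈ᵇ S) l ≡ length S
count-∈ᵇ _ [] = refl
count-∈ᵇ {S = x ∷ S} {x ∷ l} h (refl ∷ s) with ∧-elim {allB (λ y → not (x =ᶠ y)) l} h
... | fresh , rest rewrite =ᶠ-refl x =
  cong suc (trans (count-cong-on l _ fresh not-x) (count-∈ᵇ rest s))
  where
  not-x : ∀ y → not (x =ᶠ y) ≡ true → (y ∈ᵇ (x ∷ S)) ≡ (y ∈ᵇ S)
  not-x y x≠y with x =ᶠ y
  ... | false = refl
count-∈ᵇ {S = S} {x ∷ l} h (x ∷ʳ s) with ∧-elim {allB (λ y → not (x =ᶠ y)) l} h
... | fresh , rest rewrite fresh-∉ x S (allB-⊆ _ s fresh) = count-∈ᵇ rest s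

-- For injective σ, the edges {s → σ s : s ∈ S} form a matching
-- exactly when σ(S) ∩ S = ∅: no edge is a loop, and two edges s → σ s, u → σ u can only
-- meet through s = σ u or u = σ s (as σ s = σ u would force s = u).

avoidsAt : ∀ {D n} → List (Fin D) → (Fin n → Bool) → Vec (Fin D) n → Bool
avoidsAt {n = n} T c w = allB (λ i → not (c i) ∨ not (lookup w i ∈ᵇ T)) (allFin n)

edge : ∀ {d} → Vec (Fin d) d → Fin d → Fin d × Fin d
edge σ s = (s , lookup σ s)

module _ {d : ℕ} (σ : Vec (Fin d) d) (σ-inj : ∀ i j → (lookup σ i =ᶠ lookup σ j) ≡ (i =ᶠ j)) where
  open ∧-Solver Bool.∧-idempotentCommutativeMonoid using (solve; _⊜_; _⊕_)

  share-edges : ∀ s u → (s =ᶠ u) ≡ false →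
                not (share (edge σ s) (edge σ u)) ≡ (not (s =ᶠ lookup σ u) ∧ not (u =ᶠ lookup σ s))
  share-edges s u s≠u rewrite σ-inj s u | s≠u | =ᶠ-sym (lookup σ s) u with s =ᶠ lookup σ u | u =ᶠ lookup σ s
  ... | true  | _     = refl
  ... | false | true  = refl
  ... | false | false = refl

  isMatching-edges : (S : List (Fin d)) → distinct S ≡ true →
                     isMatching (map (edge σ) S) ≡ allB (λ s → not (lookup σ s ∈ᵇ S)) S
  isMatching-edges []      _ = refl
  isMatching-edges (s ∷ S) h with ∧-elim {allB (λ y → not (s =ᶠ y)) S} h
  ... | fresh , rest = begin
      not loop ∧ (allB (λ f → not (share (edge σ s) f)) (map (edge σ) S) ∧ isMatching (map (edge σ) S))
    ≡⟨ cong₂ (λ x y → not loop ∧ (x ∧ y)) shares (isMatching-edges S rest) ⟩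
      not loop ∧ ((headsOut ∧ tailsOut) ∧ restOut)
    ≡⟨ solve 4 (λ l h t r → (l ⊕ ((h ⊕ t) ⊕ r)) ⊜ ((l ⊕ t) ⊕ (h ⊕ r)))
               refl (not loop) headsOut tailsOut restOut ⟩
      (not loop ∧ tailsOut) ∧ (headsOut ∧ restOut)
    ≡⟨ sym (cong₂ _∧_ (trans (not-∨ loop _) (cong (not loop ∧_) (not-∈ᵇ (lookup σ s) S)))
                      (trans (allB-cong S (λ u → not-∨ (s =ᶠ lookup σ u) _)) (allB-∧ S _ _))) ⟩
      allB (λ t → not (lookup σ t ∈ᵇ (s ∷ S))) (s ∷ S) ∎
    where
    open ≡-Reasoning
    loop     = s =ᶠ lookup σ s
    headsOut = allB (λ u → not (s =ᶠ lookup σ u)) S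
    tailsOut = allB (λ u → not (u =ᶠ lookup σ s)) S
    restOut  = allB (λ u → not (lookup σ u ∈ᵇ S)) S
    shares : allB (λ f → not (share (edge σ s) f)) (map (edge σ) S) ≡ (headsOut ∧ tailsOut)
    shares = trans (allB-map (edge σ) _ S)
      (trans (allB-cong-on S _ fresh (λ u s≠u → share-edges s u (trans (sym (Bool.not-involutive _)) (cong not s≠u))))
             (allB-∧ S _ _))

matchings-Gσ : ∀ {d} (σ : Vec (Fin d) d) m → distinct (toList σ) ≡ true →
               a (Gσ σ) m ≡ Σ (sublists (allFin d)) (λ S → ι (avoidsAt S (_∈ᵇ S) σ) * ι (length S ≡ᵇ m))
matchings-Gσ {d} σ m σ-distinct = begin
    count (isMatchingOfSize m) (sublists (map (edge σ) (allFin d)))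
  ≡⟨ cong (count (isMatchingOfSize m)) (sublists-map (edge σ) (allFin d)) ⟩
    count (isMatchingOfSize m) (map (map (edge σ)) (sublists (allFin d)))
  ≡⟨ count-map (map (edge σ)) (sublists (allFin d)) (isMatchingOfSize m) ⟩
    count (isMatchingOfSize m ∘ map (edge σ)) (sublists (allFin d))
  ≡⟨ count≡Σ _ (sublists (allFin d)) ⟩
    Σ (sublists (allFin d)) (ι ∘ isMatchingOfSize m ∘ map (edge σ))
  ≡⟨ Σ-sublists-cong (allFin d) per-set ⟩
    Σ (sublists (allFin d)) (λ S → ι (avoidsAt S (_∈ᵇ S) σ) * ι (length S ≡ᵇ m)) ∎
  where
  open ≡-Reasoning
  per-set : ∀ S → S ⊆ allFin d →
            ι (isMatchingOfSize m (map (edge σ) S)) ≡ ι (avoidsAt S (_∈ᵇ S) σ) * ι (length S ≡ᵇ m)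
  per-set S S⊆ = trans (ι-∧ (isMatching (map (edge σ) S)) _) (cong₂ (λ x y → ι x * ι (y ≡ᵇ m))
    (trans (isMatching-edges σ (distinct-=ᶠ σ σ-distinct) S (distinct-⊆ S⊆ (distinct-allFin d)))
           (allB-restrict (λ s → not (lookup σ s ∈ᵇ S)) S))
    (List.length-map (edge σ) S))

-- Falling factorials n ↓ k = n (n-1) ⋯ (n-k+1), the number of ways to fill k
-- positions injectively from n values, one position at a time.

infix 8 _↓_

_↓_ : ℕ → ℕ → ℕ
n ↓ zero  = 1
n ↓ suc k = n * (pred n ↓ k)

∸-suc : ∀ n k → n ∸ suc k ≡ pred n ∸ k
∸-suc zero    k = trans (ℕ.0∸n≡0 (suc k)) (sym (ℕ.0∸n≡0 k))
∸-suc (suc n) k = refl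

↓-suc : ∀ n k → n ↓ suc k ≡ n ↓ k * (n ∸ k)
↓-suc n zero    = trans (ℕ.*-identityʳ n) (sym (ℕ.+-identityʳ n))
↓-suc n (suc k) = begin
    n * (pred n ↓ suc k)          ≡⟨ cong (n *_) (↓-suc (pred n) k) ⟩
    n * ((pred n ↓ k) * (pred n ∸ k)) ≡⟨ sym (ℕ.*-assoc n _ _) ⟩
    n * (pred n ↓ k) * (pred n ∸ k)   ≡⟨ cong (n * (pred n ↓ k) *_) (sym (∸-suc n k)) ⟩
    n * (pred n ↓ k) * (n ∸ suc k)    ∎
  where open ≡-Reasoning

↓-self : ∀ n → n ↓ n ≡ n !
↓-self zero    = refl
↓-self (suc n) = cong (suc n *_) (↓-self n)

↓-fact : ∀ {n k} → k ≤ n → n ↓ k * (n ∸ k) ! ≡ n !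
↓-fact {n} z≤n = ℕ.+-identityʳ (n !)
↓-fact {suc n} {suc k} (s≤s k≤n) = trans (ℕ.*-assoc (suc n) (n ↓ k) _) (cong (suc n *_) (↓-fact k≤n))

↓-zero : ∀ {n k} → n < k → n ↓ k ≡ 0
↓-zero {zero}  {suc k} _         = refl
↓-zero {suc n} {suc k} (s≤s n<k) = trans (cong (suc n *_) (↓-zero n<k)) (ℕ.*-zeroʳ (suc n))

-- There are p values usable everywhere and q more values usable only at positions not
-- selected by c; filling the # c selected positions first gives p ↓ # c choices, after
-- which p - # c + q values remain for the other positions.

placements : ℕ → ℕ → ℕ → ℕ → ℕ
placements p q k l = p ↓ k * (p ∸ k + q) ↓ l

pred-+ˡ : ∀ t q (f : ℕ → ℕ) → t * f (pred t + q) ≡ t * f (pred (t + q))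
pred-+ˡ zero    q f = refl
pred-+ˡ (suc t) q f = refl

pred-+ʳ : ∀ t q (f : ℕ → ℕ) → q * f (t + pred q) ≡ q * f (pred (t + q))
pred-+ʳ t zero    f = refl
pred-+ʳ t (suc q) f = cong (λ z → suc q * f (pred z)) (sym (ℕ.+-suc t q))

-- the closed form satisfies the first-position recursion: the first position takes one
-- of the p values, or (if it is unselected, b = false) one of the q values
placements-step : ∀ b p q k l →
  placements p q (ι b + k) (ι (not b) + l) ≡
  p * placements (pred p) q k l + ι (not b) * (q * placements p (pred q) k l)
placements-step true p q k l = begin
    p * (pred p ↓ k) * ((p ∸ suc k + q) ↓ l)
  ≡⟨ cong (λ z → p * (pred p ↓ k) * ((z + q) ↓ l)) (∸-suc p k) ⟩
    p * (pred p ↓ k) * ((pred p ∸ k + q) ↓ l)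
  ≡⟨ ℕ.*-assoc p _ _ ⟩
    p * placements (pred p) q k l
  ≡⟨ sym (ℕ.+-identityʳ _) ⟩
    p * placements (pred p) q k l + 0 ∎
  where open ≡-Reasoning
placements-step false p q k l = sym (begin
    p * ((pred p ↓ k) * ((pred p ∸ k + q) ↓ l)) + (q * (F * ((t + pred q) ↓ l)) + 0)
  ≡⟨ cong₂ _+_ (sym (ℕ.*-assoc p _ _)) (ℕ.+-identityʳ _) ⟩
    p ↓ suc k * ((pred p ∸ k + q) ↓ l) + q * (F * ((t + pred q) ↓ l))
  ≡⟨ cong₂ (λ u v → u * ((v + q) ↓ l) + q * (F * ((t + pred q) ↓ l)))
           (↓-suc p k) (trans (sym (∸-suc p k)) (sym (ℕ.pred[m∸n]≡m∸[1+n] p k))) ⟩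
    F * t * ((pred t + q) ↓ l) + q * (F * ((t + pred q) ↓ l))
  ≡⟨ cong₂ _+_ (trans (ℕ.*-assoc F t _) (cong (F *_) (pred-+ˡ t q (_↓ l))))
               (trans (x∙yz≈y∙xz q F _) (cong (F *_) (pred-+ʳ t q (_↓ l)))) ⟩
    F * (t * X) + F * (q * X)
  ≡⟨ sym (ℕ.*-distribˡ-+ F (t * X) (q * X)) ⟩
    F * (t * X + q * X)
  ≡⟨ cong (F *_) (sym (ℕ.*-distribʳ-+ X t q)) ⟩
    F * ((t + q) * X) ∎)
  where
  open ≡-Reasoning
  open import Algebra.Properties.CommutativeSemigroup ℕ.*-commutativeSemigroup using (x∙yz≈y∙xz)
  F = p ↓ k
  t = p ∸ k
  X = pred (t + q) ↓ l

injections : ∀ {n} → (Fin n → Bool) → ℕ → ℕ → ℕ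
injections c p q = placements p q (# c) (# (not ∘ c))

injections-step : ∀ {n} (c : Fin (suc n) → Bool) p q →
  injections c p q ≡ p * injections (c ∘ suc) (pred p) q + ι (not (c zero)) * (q * injections (c ∘ suc) p (pred q))
injections-step c p q = trans (cong₂ (placements p q) (#-step c) (#-step (not ∘ c)))
                              (placements-step (c zero) p q (# (c ∘ suc)) (# (not ∘ c ∘ suc)))

-- the case q = k, l = p: both sides vanish if k > p, and otherwise p - k + k = p
placements-balanced : ∀ p k → placements p k k p ≡ p ↓ k * p !
placements-balanced p k with k ≤? p
... | yes k≤p rewrite ℕ.m∸n+n≡m k≤p = cong (p ↓ k *_) (↓-self p)
... | no k≰p rewrite ↓-zero (ℕ.≰⇒> k≰p) = refl

-- Fix a set T of values.  A sequence w is admissible after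
-- the values U have been used if its entries are distinct, avoid U, and avoid T at the
-- positions selected by c.  Choosing entries one at a time, the count depends only on the
-- numbers of unused values outside and inside T, and equals `injections`.

module AdmissibleSequences {D : ℕ} (T : List (Fin D)) where
  open ∧-Solver Bool.∧-idempotentCommutativeMonoid using (solve; _⊜_; _⊕_)

  allowed : Bool → List (Fin D) → Fin D → Bool
  allowed b U x = not (x ∈ᵇ U) ∧ (not b ∨ not (x ∈ᵇ T))

  admissible : ∀ {n} → (Fin n → Bool) → List (Fin D) → Vec (Fin D) n → Bool
  admissible c U []      = true
  admissible c U (x ∷ w) = allowed (c zero) U x ∧ admissible (c ∘ suc) (x ∷ U) w

  freeOut freeIn : List (Fin D) → ℕ
  freeOut U = count (λ y → not (y ∈ᵇ U) ∧ not (y ∈ᵇ T)) (allFin D)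
  freeIn  U = count (λ y → not (y ∈ᵇ U) ∧ (y ∈ᵇ T)) (allFin D)

  use : ∀ x U (r : Fin D → Bool) →
        count (λ y → not (y ∈ᵇ U) ∧ r y) (allFin D) ≡
        count (λ y → not (y ∈ᵇ (x ∷ U)) ∧ r y) (allFin D) + ι (not (x ∈ᵇ U) ∧ r x)
  use x U r = trans (count-split (x =ᶠ_) _ (allFin D))
    (cong₂ _+_ (count-cong (allFin D) (λ y → sym (trans (cong (_∧ r y) (not-∨ (x =ᶠ y) _))
                                                         (Bool.∧-assoc (not (x =ᶠ y)) (not (y ∈ᵇ U)) (r y)))))
               (count-at x _))

  choice-cases : ∀ inU inT b (g : ℕ → ℕ → ℕ) {p′ q′ p q : ℕ} →
    p ≡ p′ + ι (not inU ∧ not inT) → q ≡ q′ + ι (not inU ∧ inT) →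
    ι (not inU ∧ (not b ∨ not inT)) * g p′ q′ ≡
    ι (not inU ∧ not inT) * g (pred p) q + ι (not b) * (ι (not inU ∧ inT) * g p (pred q))
  choice-cases true  inT   b     g _ _ = sym (ℕ.*-zeroʳ (ι (not b)))
  choice-cases false true  true  g _ _ = refl
  choice-cases false true  false g {p′} {q′} refl refl rewrite ℕ.+-identityʳ p′ | ℕ.+-comm q′ 1 = sym (ℕ.+-identityʳ _)
  choice-cases false false b     g {p′} {q′} refl refl rewrite ℕ.+-identityʳ q′ | ℕ.+-comm p′ 1 = lemma b
    where
    lemma : ∀ b → ι (not b ∨ true) * g p′ q′ ≡ 1 * g p′ q′ + ι (not b) * 0
    lemma true  = sym (ℕ.+-identityʳ _)
    lemma false = sym (ℕ.+-identityʳ _)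

  choose-first : ∀ b U (g : ℕ → ℕ → ℕ) →
    Σ (allFin D) (λ x → ι (allowed b U x) * g (freeOut (x ∷ U)) (freeIn (x ∷ U))) ≡
    freeOut U * g (pred (freeOut U)) (freeIn U) + ι (not b) * (freeIn U * g (freeOut U) (pred (freeIn U)))
  choose-first b U g = begin
      Σ (allFin D) (λ x → ι (allowed b U x) * g (freeOut (x ∷ U)) (freeIn (x ∷ U)))
    ≡⟨ Σ-cong (allFin D) (λ x → choice-cases (x ∈ᵇ U) (x ∈ᵇ T) b g
                                   (use x U (not ∘ (_∈ᵇ T))) (use x U (_∈ᵇ T))) ⟩
      Σ (allFin D) (λ x → ι (out x) * K₁ + ι (not b) * (ι (in′ x) * K₂))
    ≡⟨ Σ-+ (allFin D) _ _ ⟩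
      Σ (allFin D) (λ x → ι (out x) * K₁) + Σ (allFin D) (λ x → ι (not b) * (ι (in′ x) * K₂))
    ≡⟨ cong₂ _+_ (Σ-count out (allFin D) K₁)
                 (trans (Σ-*ˡ (allFin D) (ι (not b)) _) (cong (ι (not b) *_) (Σ-count in′ (allFin D) K₂))) ⟩
      freeOut U * K₁ + ι (not b) * (freeIn U * K₂) ∎
    where
    open ≡-Reasoning
    out in′ : Fin D → Bool
    out x = not (x ∈ᵇ U) ∧ not (x ∈ᵇ T)
    in′ x = not (x ∈ᵇ U) ∧ (x ∈ᵇ T)
    K₁ = g (pred (freeOut U)) (freeIn U)
    K₂ = g (freeOut U) (pred (freeIn U))

  first-entry : ∀ n (c : Fin (suc n) → Bool) U →
    Σ (allVecs D (suc n)) (ι ∘ admissible c U) ≡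
    Σ (allFin D) (λ x → ι (allowed (c zero) U x) * Σ (allVecs D n) (ι ∘ admissible (c ∘ suc) (x ∷ U)))
  first-entry n c U = trans (Σ-concatMap _ (allFin D) _) (Σ-cong (allFin D) λ x →
    trans (Σ-map (x ∷_) (allVecs D n) _)
      (trans (Σ-cong (allVecs D n) (λ w → ι-∧ (allowed (c zero) U x) (admissible (c ∘ suc) (x ∷ U) w)))
             (Σ-*ˡ (allVecs D n) (ι (allowed (c zero) U x)) (ι ∘ admissible (c ∘ suc) (x ∷ U)))))

  count-admissible : ∀ n (c : Fin n → Bool) U →
    Σ (allVecs D n) (ι ∘ admissible c U) ≡ injections c (freeOut U) (freeIn U)
  count-admissible zero    c U = refl
  count-admissible (suc n) c U = begin
      Σ (allVecs D (suc n)) (ι ∘ admissible c U)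
    ≡⟨ first-entry n c U ⟩
      Σ (allFin D) (λ x → ι (allowed (c zero) U x) * Σ (allVecs D n) (ι ∘ admissible (c ∘ suc) (x ∷ U)))
    ≡⟨ Σ-cong (allFin D) (λ x → cong (ι (allowed (c zero) U x) *_) (count-admissible n (c ∘ suc) (x ∷ U))) ⟩
      Σ (allFin D) (λ x → ι (allowed (c zero) U x) * injections (c ∘ suc) (freeOut (x ∷ U)) (freeIn (x ∷ U)))
    ≡⟨ choose-first (c zero) U (injections (c ∘ suc)) ⟩
      freeOut U * injections (c ∘ suc) (pred (freeOut U)) (freeIn U)
        + ι (not (c zero)) * (freeIn U * injections (c ∘ suc) (freeOut U) (pred (freeIn U)))
    ≡⟨ sym (injections-step c (freeOut U) (freeIn U)) ⟩
      injections c (freeOut U) (freeIn U) ∎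
    where open ≡-Reasoning

  avoidsAt-step : ∀ {n} (c : Fin (suc n) → Bool) x (w : Vec (Fin D) n) →
                  avoidsAt T c (x ∷ w) ≡ ((not (c zero) ∨ not (x ∈ᵇ T)) ∧ avoidsAt T (c ∘ suc) w)
  avoidsAt-step {n} c x w = cong ((not (c zero) ∨ not (x ∈ᵇ T)) ∧_)
    (trans (cong (allB _) (sym (List.map-tabulate {n = n} (λ i → i) suc))) (allB-map suc _ (allFin n)))

  unused-step : ∀ x U (l : List (Fin D)) →
    allB (λ y → not (y ∈ᵇ (x ∷ U))) l ≡ (allB (λ y → not (x =ᶠ y)) l ∧ allB (λ y → not (y ∈ᵇ U)) l)
  unused-step x U l = trans (allB-cong l (λ y → not-∨ (x =ᶠ y) (y ∈ᵇ U))) (allB-∧ l _ _)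

  admissible-spec : ∀ {n} (c : Fin n → Bool) U (w : Vec (Fin D) n) →
    admissible c U w ≡ ((distinct (toList w) ∧ allB (λ y → not (y ∈ᵇ U)) (toList w)) ∧ avoidsAt T c w)
  admissible-spec c U []      = refl
  admissible-spec c U (x ∷ w) = begin
      (notUsed ∧ fits) ∧ admissible (c ∘ suc) (x ∷ U) w
    ≡⟨ cong ((notUsed ∧ fits) ∧_) (trans (admissible-spec (c ∘ suc) (x ∷ U) w)
                                         (cong (λ z → (dist ∧ z) ∧ rest) (unused-step x U (toList w)))) ⟩
      (notUsed ∧ fits) ∧ ((dist ∧ (new ∧ unused)) ∧ rest)
    ≡⟨ solve 6 (λ a b c d e f → ((a ⊕ b) ⊕ ((d ⊕ (c ⊕ e)) ⊕ f)) ⊜ (((c ⊕ d) ⊕ (a ⊕ e)) ⊕ (b ⊕ f)))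
               refl notUsed fits new dist unused rest ⟩
      ((new ∧ dist) ∧ (notUsed ∧ unused)) ∧ (fits ∧ rest)
    ≡⟨ cong (((new ∧ dist) ∧ (notUsed ∧ unused)) ∧_) (sym (avoidsAt-step c x w)) ⟩
      ((new ∧ dist) ∧ (notUsed ∧ unused)) ∧ avoidsAt T c (x ∷ w) ∎
    where
    open ≡-Reasoning
    notUsed = not (x ∈ᵇ U)
    fits    = not (c zero) ∨ not (x ∈ᵇ T)
    new     = allB (λ y → not (x =ᶠ y)) (toList w)
    dist    = distinct (toList w)
    unused  = allB (λ y → not (y ∈ᵇ U)) (toList w)
    rest    = avoidsAt T (c ∘ suc) w

  admissible-from-scratch : ∀ {n} (c : Fin n → Bool) (w : Vec (Fin D) n) →
                            admissible c [] w ≡ (distinct (toList w) ∧ avoidsAt T c w)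
  admissible-from-scratch c w = trans (admissible-spec c [] w)
    (cong (_∧ avoidsAt T c w) (trans (cong (distinct (toList w) ∧_) (allB-true (toList w))) (Bool.∧-identityʳ _)))

open AdmissibleSequences using (admissible; admissible-from-scratch; count-admissible)

-- The number of permutations σ of [d] with σ(S) ∩ S = ∅ for a k-set S is (d-k) ↓ k · (d-k)!:
-- the k vertices of S are sent injectively outside S, then the rest fill the d-k free places.
avoiding-permutations : ∀ d (S : List (Fin d)) → S ⊆ allFin d →
  Σ (allVecs d d) (ι ∘ admissible S (_∈ᵇ S) []) ≡ (d ∸ length S) ↓ length S * (d ∸ length S) !
avoiding-permutations d S S⊆ = begin
    Σ (allVecs d d) (ι ∘ admissible S (_∈ᵇ S) [])
  ≡⟨ count-admissible S d (_∈ᵇ S) [] ⟩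
    p ↓ k * (p ∸ k + k) ↓ p
  ≡⟨ placements-balanced p k ⟩
    p ↓ k * p !
  ≡⟨ cong₂ (λ p k → p ↓ k * p !) p≡ k≡ ⟩
    (d ∸ length S) ↓ length S * (d ∸ length S) ! ∎
  where
  open ≡-Reasoning
  k = count (_∈ᵇ S) (allFin d)
  p = count (not ∘ (_∈ᵇ S)) (allFin d)
  k≡ : k ≡ length S
  k≡ = count-∈ᵇ (distinct-allFin d) S⊆
  p≡ : p ≡ d ∸ length S
  p≡ = trans (sym (ℕ.m+n∸n≡m p k))
             (cong₂ _∸_ (trans (count-not (_∈ᵇ S) (allFin d)) (List.length-tabulate (λ i → i))) k≡)

matchings-per-vector : ∀ d m (v : Vec (Fin d) d) →
  (if distinct (toList v) then a (Gσ v) m else 0) ≡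
  Σ (sublists (allFin d)) (λ S → ι (admissible S (_∈ᵇ S) [] v) * ι (length S ≡ᵇ m))
matchings-per-vector d m v with distinct (toList v) in v-distinct
... | true  = trans (matchings-Gσ v m v-distinct) (Σ-cong (sublists (allFin d))
                (λ S → cong (λ b → ι b * ι (length S ≡ᵇ m)) (sym (scratch S))))
  where
  scratch : ∀ S → admissible S (_∈ᵇ S) [] v ≡ avoidsAt S (_∈ᵇ S) v
  scratch S = trans (admissible-from-scratch S (_∈ᵇ S) v) (cong (_∧ avoidsAt S (_∈ᵇ S) v) v-distinct)
... | false = sym (trans (Σ-cong (sublists (allFin d)) (λ S → cong (λ b → ι b * ι (length S ≡ᵇ m)) (scratch S)))
                         (Σ-zero (sublists (allFin d))))
  where
  scratch : ∀ S → admissible S (_∈ᵇ S) [] v ≡ false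
  scratch S = trans (admissible-from-scratch S (_∈ᵇ S) v) (cong (_∧ avoidsAt S (_∈ᵇ S) v) v-distinct)

ι-≡ᵇ : ∀ (f : ℕ → ℕ) k m → f k * ι (k ≡ᵇ m) ≡ f m * ι (k ≡ᵇ m)
ι-≡ᵇ f k m with k ≡ᵇ m in k=m
... | true  = cong (λ z → f z * 1) (ℕ.≡ᵇ⇒≡ k m (subst T (sym k=m) tt))
... | false = trans (ℕ.*-zeroʳ (f k)) (sym (ℕ.*-zeroʳ (f m)))

-- Σ_σ a(G_σ, m): exchange the sums over permutations σ and over m-sets S
sum-matchings-Gσ : ∀ d m → Σ (perms d) (λ σ → a (Gσ σ) m) ≡ ((d ∸ m) ↓ m * (d ∸ m) !) * (d C m)
sum-matchings-Gσ d m = begin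
    Σ (filterᵇ (λ v → distinct (toList v)) (allVecs d d)) (λ σ → a (Gσ σ) m)
  ≡⟨ Σ-filter _ (allVecs d d) _ ⟩
    Σ (allVecs d d) (λ v → if distinct (toList v) then a (Gσ v) m else 0)
  ≡⟨ Σ-cong (allVecs d d) (matchings-per-vector d m) ⟩
    Σ (allVecs d d) (λ v → Σ sets (λ S → ι (admissible S (_∈ᵇ S) [] v) * ι (length S ≡ᵇ m)))
  ≡⟨ Σ-swap (allVecs d d) sets _ ⟩
    Σ sets (λ S → Σ (allVecs d d) (λ v → ι (admissible S (_∈ᵇ S) [] v) * ι (length S ≡ᵇ m)))
  ≡⟨ Σ-sublists-cong (allFin d) per-set ⟩
    Σ sets (λ S → V * ι (length S ≡ᵇ m))
  ≡⟨ Σ-*ˡ sets V _ ⟩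
    V * Σ sets (λ S → ι (length S ≡ᵇ m))
  ≡⟨ cong (V *_) (sym (count≡Σ _ sets)) ⟩
    V * count (λ S → length S ≡ᵇ m) sets
  ≡⟨ cong (V *_) (trans (count-sublists-of-length (allFin d) m) (cong (_C m) (List.length-tabulate (λ i → i)))) ⟩
    V * (d C m) ∎
  where
  open ≡-Reasoning
  sets = sublists (allFin d)
  V = (d ∸ m) ↓ m * (d ∸ m) !
  per-set : ∀ S → S ⊆ allFin d →
            Σ (allVecs d d) (λ v → ι (admissible S (_∈ᵇ S) [] v) * ι (length S ≡ᵇ m)) ≡ V * ι (length S ≡ᵇ m)
  per-set S S⊆ = trans (Σ-*ʳ (allVecs d d) (ι (length S ≡ᵇ m)) (ι ∘ admissible S (_∈ᵇ S) []))
    (trans (cong (_* ι (length S ≡ᵇ m)) (avoiding-permutations d S S⊆))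
           (ι-≡ᵇ (λ k → (d ∸ k) ↓ k * (d ∸ k) !) (length S) m))

C-fact : ∀ {n k} → k ≤ n → (n C k) * (k ! * (n ∸ k) !) ≡ n !
C-fact {n} {k} k≤n = trans (cong (_* (k ! * (n ∸ k) !)) (nCk≡n!/k![n-k]! k≤n)) (m/n*n≡m (k![n∸k]!∣n! k≤n))
  where instance _ = ℕ._!*_!≢0 k (n ∸ k)

-- d! · (d-m) C m = (d-m) ↓ m · (d-m)! · d C m, both sides being d!(d-m)!/(m!(d-2m)!)
factorial-identity : ∀ {d m} → m ≤ d → d ! * ((d ∸ m) C m) ≡ ((d ∸ m) ↓ m * (d ∸ m) !) * (d C m)
factorial-identity {d} {m} m≤d with m ≤? d ∸ m
... | no m≰u rewrite k>n⇒nCk≡0 (ℕ.≰⇒> m≰u) | ↓-zero (ℕ.≰⇒> m≰u) = ℕ.*-zeroʳ (d !)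
... | yes m≤u = ℕ.*-cancelʳ-≡ _ _ (m ! * (u ∸ m) !) {{ℕ._!*_!≢0 m (u ∸ m)}} (begin
    d ! * (u C m) * (m ! * (u ∸ m) !)                  ≡⟨ ℕ.*-assoc (d !) _ _ ⟩
    d ! * ((u C m) * (m ! * (u ∸ m) !))                ≡⟨ cong (d ! *_) (C-fact m≤u) ⟩
    d ! * u !                                          ≡⟨ ℕ.*-comm (d !) (u !) ⟩
    u ! * d !                                          ≡⟨ cong₂ _*_ (sym (↓-fact m≤u)) (sym (C-fact m≤d)) ⟩
    (u ↓ m * (u ∸ m) !) * ((d C m) * (m ! * u !))      ≡⟨ regroup (u ↓ m) ((u ∸ m) !) (d C m) (m !) (u !) ⟩
    (u ↓ m * u !) * (d C m) * (m ! * (u ∸ m) !)        ∎)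
  where
  open ≡-Reasoning
  open +-*-Solver
  u = d ∸ m
  regroup : ∀ F E B M U → (F * E) * (B * (M * U)) ≡ (F * U) * B * (M * E)
  regroup = solve 5 (λ F E B M U → (F :* E) :* (B :* (M :* U)) := (F :* U) :* B :* (M :* E)) refl

proposition5p2 : (d m : ℕ) → 1 ≤ d → m ≤ d →
    (d !) * a (P d) m ≡ sum (map (λ σ → a (Gσ σ) m) (perms d))
proposition5p2 (suc n) m (s≤s z≤n) m≤d = begin
    suc n ! * a (pathEdges n) m                       ≡⟨ cong (λ E → suc n ! * a E m) (pathEdges≡path n) ⟩
    suc n ! * a (path n) m                            ≡⟨ cong (suc n ! *_) (a-path n m) ⟩
    suc n ! * ((suc n ∸ m) C m)                       ≡⟨ factorial-identity m≤d ⟩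
    ((suc n ∸ m) ↓ m * (suc n ∸ m) !) * (suc n C m)   ≡⟨ sym (sum-matchings-Gσ (suc n) m) ⟩
    sum (map (λ σ → a (Gσ σ) m) (perms (suc n)))      ∎
  where open ≡-Reasoning
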